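{- Let $p$ and $q$ be distinct primes, $N=pq$, and let $\alpha$ be an integer with $\gcd(\alpha,N)=1$. Let $G=G_{N,\alpha}$ be the graph with vertex set $\{1,\ldots,N-1\}$ in which $i$ and $j$ are joined by an edge if and only if $j\equiv \alpha i \pmod N$. For $x\in \mathbb{Z}/N\mathbb{Z}$ let $\mathbb{Z}/N\mathbb{Z}(x)_\alpha=\{\alpha^k x \bmod N : k\ge 0\}$ denote the orbit of $x$ under multiplication by $\alpha$, and let $[a,b]$ denote the least common multiple of $a$ and $b$. Then the number $C_G$ of cycles (connected components) of $G$ is $$C_G=\frac{q-1}{|\mathbb{Z}/N\mathbb{Z}(p)_\alpha|}+\frac{p-1}{|\mathbb{Z}/N\mathbb{Z}(q)_\alpha|}+\frac{(p-1)(q-1)}{\big[\,|\mathbb{Z}/N\mathbb{Z}(p)_\alpha|,\;|\mathbb{Z}/N\mathbb{Z}(q)_\alpha|\,\big]}.$$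
   Context: Since multiplication by $\alpha$ is a permutation of $\mathbb{Z}/N\mathbb{Z}$ fixing $0$, each connected component of $G_{N,\alpha}$ is the orbit of a vertex under multiplication by $\alpha$; the paper calls these components "cycles". -}

module Defs where

open import Data.Nat using (ℕ; zero; suc; _≤_; _<_; _*_; _∸_; _+_)
open import Data.Nat.DivMod using (_/_)
open import Data.Integer as ℤ using (ℤ; +_)
open import Data.Integer.Divisibility using () renaming (_∣_ to _∣ℤ_)
open import Data.List using (List; length)
open import Data.List.Membership.Propositional using (_∈_)
open import Data.List.Relation.Unary.Unique.Propositional using (Unique)
open import Data.List.Relation.Unary.Any using (Any)
open import Data.Product using (Σ; ∃; _×_)
open import Function.Bundles using (_⇔_)
open import Relation.Binary.PropositionalEquality using (_≡_)
open import Relation.Binary.Construct.Closure.Symmetric using (SymClosure)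
open import Relation.Binary.Construct.Closure.ReflexiveTransitive using (Star)
open import Relation.Nullary using (¬_)

_≡_[mod_] : ℤ → ℤ → ℕ → Set
a ≡ b [mod N ] = (+ N) ∣ℤ (a ℤ.- b)

IsVertex : ℕ → ℕ → Set
IsVertex N i = 1 ≤ i × i < N

Edge : ℕ → ℤ → ℕ → ℕ → Set
Edge N α i j = IsVertex N i × IsVertex N j × ((+ j) ≡ α ℤ.* (+ i) [mod N ])

Connected : ℕ → ℤ → ℕ → ℕ → Set
Connected N α = Star (SymClosure (Edge N α))

NumComponents : ℕ → ℤ → ℕ → Set
NumComponents N α c =
  Σ (List ℕ) λ reps →
    length reps ≡ c ×
    (∀ r → r ∈ reps → IsVertex N r) ×
    Unique reps ×
    (∀ r s → r ∈ reps → s ∈ reps → Connected N α r s → r ≡ s) ×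
    (∀ v → IsVertex N v → Any (Connected N α v) reps)

-- Orbit of x ∈ ℤ/Nℤ under multiplication by α, with elements of ℤ/Nℤ
-- represented by their canonical residues 0 ≤ y < N:
-- y ∈ ℤ/Nℤ(x)_α  iff  y ≡ α^k x (mod N) for some k ≥ 0.
InOrbit : ℕ → ℤ → ℕ → ℕ → Set
InOrbit N α x y = y < N × ∃ λ (k : ℕ) → (+ y) ≡ (α ℤ.^ k) ℤ.* (+ x) [mod N ]

HasCard : (ℕ → Set) → ℕ → Set
HasCard P m = Σ (List ℕ) λ l → length l ≡ m × Unique l × (∀ y → (y ∈ l) ⇔ P y)

-- Total natural-number division (value 0 when dividing by 0; in the theorem
-- all divisors are provably nonzero, so this convention is never used).
_div_ : ℕ → ℕ → ℕ
m div zero = zero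
m div suc n = m / suc n

module Submission where

-- G_{N,α} is the functional graph of the permutation i ↦ α i mod N of {1,…,N-1}, so its components
-- are the orbits of that map.  The vertices split into the multiples of p prime to q, the multiples
-- of q prime to p, and the units.  For x in the first class, α^k x ≡ x (mod N) iff α^k ≡ 1 (mod q), so
-- every orbit in it has the same length: the order of α mod q, which is the size of the orbit of p.
-- Symmetrically for the second class, and on the units the Chinese remainder theorem makes the common
-- orbit length the lcm of the two orders.  A class of c vertices whose orbits all have length d
-- consists of c / d orbits, and the units number (p - 1)(q - 1) by counting the complement.

open import Data.Nat
open import Data.Nat.Properties
open import Data.Nat.DivMod using (_%_; _/_; m%n<n; m≡m%n+[m/n]*n; m*n/n≡m)
open import Data.Nat.Divisibility
  using (_∣_; _∣?_; divides; divides-refl; ∣⇒≤; >⇒∤; m%n≡0⇒n∣m; ∣-refl; ∣-trans; ∣1⇒≡1; _∣0;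
         m∣m*n; n∣m*n)
open import Data.Nat.Coprimality using (Coprime; coprime⇒gcd≡1)
open import Data.Nat.GeneralisedArithmetic using (fold; fold-+)
open import Data.Nat.LCM using (lcm; lcm-least; gcd*lcm; m∣lcm[m,n]; n∣lcm[m,n])
open import Data.Nat.Primality using (Prime; euclidsLemma; prime⇒nonZero; prime⇒nonTrivial; prime⇒irreducible)
import Data.Nat.GCD as ℕ using (gcd; gcd-greatest)
open import Data.Integer as ℤ using (ℤ; +_; 0ℤ; 1ℤ)
import Data.Integer.Properties as ℤ
open import Data.Integer.GCD using (gcd)
import Data.Integer.Divisibility.Signed as ℤ
open import Data.Integer.DivMod using (_%ℕ_; _/ℕ_; a≡a%ℕn+[a/ℕn]*n; n%ℕd<d)
open import Data.Integer.Tactic.RingSolver using (solve-∀)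
open import Data.Fin using (toℕ)
import Data.Fin.Properties as Fin
open import Data.List using (List; []; _∷_; length; _++_; filter; applyUpTo; lookup)
open import Data.List.Properties using (length-++; length-applyUpTo)
open import Data.List.Membership.Propositional using (_∈_; _∉_)
open import Data.List.Membership.Propositional.Properties
  using (∈-applyUpTo⁺; ∈-applyUpTo⁻; ∈-filter⁺; ∈-filter⁻; ∈-++⁺ˡ; ∈-++⁺ʳ; ∈-++⁻)
open import Data.List.Membership.Propositional.Properties.WithK using (unique∧set⇒bag)
open import Data.List.Membership.DecPropositional _≟_ using (_∈?_)
open import Data.List.Relation.Binary.BagAndSetEquality using (∼bag⇒↭)
open import Data.List.Relation.Binary.Permutation.Propositional.Properties using (↭-length)
open import Data.List.Relation.Unary.Unique.Propositional using (Unique)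
import Data.List.Relation.Unary.Unique.Propositional.Properties as Unique
open import Data.List.Relation.Unary.AllPairs using ([]; _∷_)
import Data.List.Relation.Unary.All as All
open import Data.List.Relation.Unary.Any as Any using (Any; here; there)
import Data.List.Relation.Unary.Any.Properties as Any
open import Data.Product using (∃-syntax; _×_; _,_; proj₁; proj₂)
open import Data.Product.Function.NonDependent.Propositional using (_×-⇔_)
open import Data.Sum as Sum using (_⊎_; inj₁; inj₂; [_,_]′)
open import Data.Empty using (⊥; ⊥-elim)
open import Function.Bundles using (_⇔_; mk⇔; Equivalence)
import Function.Properties.Equivalence as ⇔
open import Relation.Nullary using (Dec; yes; no; ¬_; ¬?; _×-dec_)
open import Function.Base using (_∘_)
open import Relation.Binary.PropositionalEquality
open import Relation.Binary.Bundles using (Setoid)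
import Relation.Binary.Reasoning.Setoid as SetoidReasoning
open import Level using (0ℓ)
open import Relation.Binary.Construct.Closure.Symmetric using (fwd; bwd)
open import Relation.Binary.Construct.Closure.ReflexiveTransitive using (ε; _◅_; _◅◅_)
open import Defs

length-unique-≡ : {A : Set} {xs ys : List A} → Unique xs → Unique ys →
  (∀ {x} → x ∈ xs → x ∈ ys) → (∀ {x} → x ∈ ys → x ∈ xs) → length xs ≡ length ys
length-unique-≡ ux uy xs⊆ys ys⊆xs = ↭-length (∼bag⇒↭ (unique∧set⇒bag ux uy (mk⇔ xs⊆ys ys⊆xs)))

least-witness : {P : ℕ → Set} → (∀ n → Dec (P n)) →
  ∀ {n} → P n → ∃[ m ] P m × (∀ {k} → k < m → ¬ P k)
least-witness {P} P? {n} Pn = search 0 n (λ ()) (subst P (sym (+-identityʳ n)) Pn)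
  where
  search : ∀ i fuel → (∀ {k} → k < i → ¬ P k) → P (fuel + i) →
           ∃[ m ] P m × (∀ {k} → k < m → ¬ P k)
  search i zero none-below Pi = i , Pi , none-below
  search i (suc fuel) none-below P[fuel+1+i] with P? i
  ... | yes Pi = i , Pi , none-below
  ... | no ¬Pi = search (suc i) fuel none-below′ (subst P (sym (+-suc fuel i)) P[fuel+1+i])
    where
    none-below′ : ∀ {k} → k < suc i → ¬ P k
    none-below′ k<1+i with m<1+n⇒m<n∨m≡n k<1+i
    ... | inj₁ k<i = none-below k<i
    ... | inj₂ refl = ¬Pi

module Orbits (f : ℕ → ℕ) where

  iter : ℕ → ℕ → ℕ
  iter k x = fold x f k

  iter-+ : ∀ m n x → iter (m + n) x ≡ iter m (iter n x)
  iter-+ m n x = fold-+ x f m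

  iter-comm : ∀ m n x → iter m (iter n x) ≡ iter n (iter m x)
  iter-comm m n x = trans (sym (iter-+ m n x)) (trans (cong (λ k → iter k x) (+-comm m n)) (iter-+ n m x))

  Reaches : ℕ → ℕ → Set
  Reaches x y = ∃[ k ] iter k x ≡ y

  reaches-trans : ∀ {x y z} → Reaches x y → Reaches y z → Reaches x z
  reaches-trans (j , refl) (k , refl) = k + j , iter-+ k j _

  ExactPeriod : ℕ → ℕ → Set
  ExactPeriod d x = ∀ k → iter k x ≡ x ⇔ d ∣ k

  module _ {d x} (iter-d : iter d x ≡ x) where

    iter-multiple : ∀ m → iter (m * d) x ≡ x
    iter-multiple zero = refl
    iter-multiple (suc m) = trans (iter-+ d (m * d) x) (trans (cong (iter d) (iter-multiple m)) iter-d)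

    iter-% : .{{_ : NonZero d}} → ∀ k → iter k x ≡ iter (k % d) x
    iter-% k = begin
      iter k x                             ≡⟨ cong (λ j → iter j x) (m≡m%n+[m/n]*n k d) ⟩
      iter (k % d + (k / d) * d) x         ≡⟨ iter-+ (k % d) ((k / d) * d) x ⟩
      iter (k % d) (iter ((k / d) * d) x)  ≡⟨ cong (iter (k % d)) (iter-multiple (k / d)) ⟩
      iter (k % d) x                       ∎
      where open ≡-Reasoning

    reaches-sym : .{{_ : NonZero d}} → ∀ {y} → Reaches x y → Reaches y x
    reaches-sym (k , refl) = (d ∸ k % d) , (begin
      iter (d ∸ k % d) (iter k x)          ≡⟨ cong (iter (d ∸ k % d)) (iter-% k) ⟩
      iter (d ∸ k % d) (iter (k % d) x)    ≡⟨ sym (iter-+ (d ∸ k % d) (k % d) x) ⟩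
      iter (d ∸ k % d + k % d) x           ≡⟨ cong (λ j → iter j x) (m∸n+n≡m (<⇒≤ (m%n<n k d))) ⟩
      iter d x                             ≡⟨ iter-d ⟩
      x                                    ∎)
      where open ≡-Reasoning

  exactPeriod-fixes : ∀ {d x} → ExactPeriod d x → iter d x ≡ x
  exactPeriod-fixes {d} period = Equivalence.from (period d) (divides 1 (sym (*-identityˡ d)))

  exactPeriod⇒periodic : ∀ {d x} .{{_ : NonZero d}} → ExactPeriod d x → ∃[ t ] iter (suc t) x ≡ x
  exactPeriod⇒periodic {suc t} period = t , exactPeriod-fixes period

  exactPeriod-exists : ∀ {x} → ∃[ t ] iter (suc t) x ≡ x → ∃[ e ] ExactPeriod (suc e) x
  exactPeriod-exists {x} (t , fixed) with least-witness (λ k → iter (suc k) x ≟ x) {t} fixed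
  ... | e , iter-d , minimal = e , λ k → mk⇔ (fixed⇒∣ k) (λ { (divides-refl m) → iter-multiple iter-d m })
    where
    fixed⇒∣ : ∀ k → iter k x ≡ x → suc e ∣ k
    fixed⇒∣ k iter-k with k % suc e in k%d≡r
    ... | zero = m%n≡0⇒n∣m k (suc e) k%d≡r
    ... | suc r = ⊥-elim (minimal (≤-pred (subst (_< suc e) k%d≡r (m%n<n k (suc e))))
                          (trans (cong (λ j → iter j x) (sym k%d≡r)) (trans (sym (iter-% iter-d k)) iter-k)))

  orbit-repeats : ∀ {x} (l : List ℕ) → (∀ k → iter k x ∈ l) →
    ∃[ i ] ∃[ j ] i < j × iter i x ≡ iter j x
  orbit-repeats {x} l iter∈l
    with i , j , i<j , same-index ← Fin.pigeonhole (n<1+n (length l)) (λ k → Any.index (iter∈l (toℕ k))) =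
    toℕ i , toℕ j , i<j , (begin
      iter (toℕ i) x                              ≡⟨ Any.lookup-index (iter∈l (toℕ i)) ⟩
      lookup l (Any.index (iter∈l (toℕ i)))       ≡⟨ cong (lookup l) same-index ⟩
      lookup l (Any.index (iter∈l (toℕ j)))       ≡⟨ sym (Any.lookup-index (iter∈l (toℕ j))) ⟩
      iter (toℕ j) x                              ∎)
    where open ≡-Reasoning

  orbit : ℕ → ℕ → List ℕ
  orbit d x = applyUpTo (λ k → iter k x) d

  orbit-unique : ∀ {d x} → ExactPeriod d x → Unique (orbit d x)
  orbit-unique {d} {x} period = Unique.applyUpTo⁺₁ (λ k → iter k x) d distinct
    where
    distinct : ∀ {i j} → i < j → j < d → iter i x ≢ iter j x
    distinct {i} {j} i<j j<d iter-i≡iter-j = <⇒≱ (≤-<-trans (m∸n≤m j i) j<d)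
      (∣⇒≤ {{>-nonZero (m<n⇒0<n∸m i<j)}} (Equivalence.to (period (j ∸ i)) fixed))
      where
      open ≡-Reasoning
      back : iter (d ∸ i) (iter i x) ≡ iter d x
      back = trans (sym (iter-+ (d ∸ i) i x)) (cong (λ k → iter k x) (m∸n+n≡m (<⇒≤ (<-trans i<j j<d))))
      fixed : iter (j ∸ i) x ≡ x
      fixed = begin
        iter (j ∸ i) x                            ≡⟨ cong (iter (j ∸ i)) (sym (exactPeriod-fixes period)) ⟩
        iter (j ∸ i) (iter d x)                   ≡⟨ cong (iter (j ∸ i)) (sym (back)) ⟩
        iter (j ∸ i) (iter (d ∸ i) (iter i x))    ≡⟨ iter-comm (j ∸ i) (d ∸ i) (iter i x) ⟩
        iter (d ∸ i) (iter (j ∸ i) (iter i x))    ≡⟨ cong (iter (d ∸ i)) (sym (iter-+ (j ∸ i) i x)) ⟩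
        iter (d ∸ i) (iter (j ∸ i + i) x)         ≡⟨ cong (λ k → iter (d ∸ i) (iter k x))
                                                          (m∸n+n≡m (<⇒≤ i<j)) ⟩
        iter (d ∸ i) (iter j x)                   ≡⟨ cong (iter (d ∸ i)) (sym iter-i≡iter-j) ⟩
        iter (d ∸ i) (iter i x)                   ≡⟨ back ⟩
        iter d x                                  ≡⟨ exactPeriod-fixes period ⟩
        x                                         ∎

  ∈-orbit⇔ : ∀ {d x y} .{{_ : NonZero d}} → ExactPeriod d x → y ∈ orbit d x ⇔ Reaches x y
  ∈-orbit⇔ {d} {x} period = mk⇔ to from
    where
    to : ∀ {y} → y ∈ orbit d x → Reaches x y
    to y∈ with k , _ , refl ← ∈-applyUpTo⁻ (λ k → iter k x) y∈ = k , refl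
    from : ∀ {y} → Reaches x y → y ∈ orbit d x
    from (k , refl) = subst (_∈ orbit d x) (sym (iter-% (exactPeriod-fixes period) k))
                        (∈-applyUpTo⁺ (λ k → iter k x) (m%n<n k d))

  exactPeriod≡card : ∀ {d x} .{{_ : NonZero d}} → ExactPeriod d x →
    {l : List ℕ} → Unique l → (∀ y → y ∈ l ⇔ Reaches x y) → length l ≡ d
  exactPeriod≡card {d} {x} period {l} unique-l ∈l⇔ = begin
    length l          ≡⟨ length-unique-≡ unique-l (orbit-unique period)
                           (λ {y} y∈l → Equivalence.from (∈-orbit⇔ period) (Equivalence.to (∈l⇔ y) y∈l))
                           (λ {y} y∈O → Equivalence.from (∈l⇔ y) (Equivalence.to (∈-orbit⇔ period) y∈O)) ⟩
    length (orbit d x) ≡⟨ length-applyUpTo (λ k → iter k x) d ⟩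
    d                  ∎
    where open ≡-Reasoning

  Closed : List ℕ → Set
  Closed S = ∀ {x} → x ∈ S → f x ∈ S

  iter-closed : ∀ {S} → Closed S → ∀ {x} → x ∈ S → ∀ k → iter k x ∈ S
  iter-closed closed x∈S zero = x∈S
  iter-closed closed x∈S (suc k) = closed (iter-closed closed x∈S k)

  closed-++ : ∀ {S₁ S₂} → Closed S₁ → Closed S₂ → Closed (S₁ ++ S₂)
  closed-++ {S₁} closed₁ closed₂ x∈ =
    [ ∈-++⁺ˡ ∘ closed₁ , ∈-++⁺ʳ S₁ ∘ closed₂ ]′ (∈-++⁻ S₁ x∈)

  record OrbitsOfPeriod (d : ℕ) (S : List ℕ) : Set where
    field
      unique : Unique S
      closed : Closed S
      period : ∀ {x} → x ∈ S → ExactPeriod d x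

  record OrbitRepresentatives (S reps : List ℕ) : Set where
    field
      reps⊆S : ∀ {r} → r ∈ reps → r ∈ S
      unique : Unique reps
      separated : ∀ {r s} → r ∈ reps → s ∈ reps → Reaches r s → r ≡ s
      covers : ∀ {y} → y ∈ S → Any (Reaches y) reps

  removeOrbit : ℕ → ℕ → List ℕ → List ℕ
  removeOrbit d x = filter (λ y → ¬? (y ∈? orbit d x))

  module _ {d S} .{{_ : NonZero d}} (U : OrbitsOfPeriod d S) {x} (x∈S : x ∈ S) where
    open OrbitsOfPeriod U

    private
      S′ : List ℕ
      S′ = removeOrbit d x S
      outside? : ∀ y → Dec (y ∉ orbit d x)
      outside? y = ¬? (y ∈? orbit d x)
      ∈-orbit⇔′ : ∀ {y} → y ∈ orbit d x ⇔ Reaches x y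
      ∈-orbit⇔′ = ∈-orbit⇔ (period x∈S)

    ∈-removeOrbit⁻ : ∀ {y} → y ∈ S′ → y ∈ S × y ∉ orbit d x
    ∈-removeOrbit⁻ = ∈-filter⁻ outside?

    orbit⊆ : ∀ {y} → y ∈ orbit d x → y ∈ S
    orbit⊆ y∈O with k , refl ← Equivalence.to ∈-orbit⇔′ y∈O = iter-closed closed x∈S k

    removeOrbit-orbitsOfPeriod : OrbitsOfPeriod d S′
    removeOrbit-orbitsOfPeriod = record
      { unique = Unique.filter⁺ outside? unique
      ; closed = closed′
      ; period = λ y∈S′ → period (proj₁ (∈-removeOrbit⁻ y∈S′))
      }
      where
      closed′ : Closed S′
      closed′ {y} y∈S′ with y∈S , y∉O ← ∈-removeOrbit⁻ y∈S′ =
        ∈-filter⁺ outside? (closed y∈S) λ fy∈O → y∉O (Equivalence.from ∈-orbit⇔′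
          (reaches-trans (Equivalence.to ∈-orbit⇔′ fy∈O)
                         (reaches-sym (exactPeriod-fixes (period y∈S)) (1 , refl))))

    length-removeOrbit : length S ≡ d + length S′
    length-removeOrbit = begin
      length S                       ≡⟨ length-unique-≡ unique unique-split split join ⟩
      length (orbit d x ++ S′)       ≡⟨ length-++ (orbit d x) ⟩
      length (orbit d x) + length S′ ≡⟨ cong (_+ length S′) (length-applyUpTo (λ k → iter k x) d) ⟩
      d + length S′                  ∎
      where
      open ≡-Reasoning
      unique-split : Unique (orbit d x ++ S′)
      unique-split = Unique.++⁺ (orbit-unique (period x∈S)) (Unique.filter⁺ outside? unique)
                       (λ (y∈O , y∈S′) → proj₂ (∈-removeOrbit⁻ y∈S′) y∈O)
      split : ∀ {y} → y ∈ S → y ∈ orbit d x ++ S′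
      split {y} y∈S with y ∈? orbit d x
      ... | yes y∈O = ∈-++⁺ˡ y∈O
      ... | no y∉O = ∈-++⁺ʳ (orbit d x) (∈-filter⁺ outside? y∈S y∉O)
      join : ∀ {y} → y ∈ orbit d x ++ S′ → y ∈ S
      join y∈ = [ orbit⊆ , (λ y∈S′ → proj₁ (∈-removeOrbit⁻ y∈S′)) ]′ (∈-++⁻ (orbit d x) y∈)

    length-removeOrbit-< : length S′ < length S
    length-removeOrbit-< = subst (length S′ <_) (sym length-removeOrbit) (m<n+m (length S′) (>-nonZero⁻¹ d))

    orbitRepresentatives-∷ : ∀ {reps} → OrbitRepresentatives S′ reps → OrbitRepresentatives S (x ∷ reps)
    orbitRepresentatives-∷ {reps} R = record
      { reps⊆S = λ { (here refl) → x∈S ; (there r∈reps) → reps⊆S r∈reps }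
      ; unique = All.tabulate (λ r∈reps x≡r → ∉orbit r∈reps (subst (_∈ orbit d x) x≡r (x⇝ (0 , refl))))
                 ∷ R.unique
      ; separated = λ
          { (here refl) (here refl) _ → refl
          ; (here refl) (there s∈reps) x⇝s → ⊥-elim (∉orbit s∈reps (x⇝ x⇝s))
          ; (there r∈reps) (here refl) r⇝x →
              ⊥-elim (∉orbit r∈reps (x⇝ (reaches-sym (exactPeriod-fixes (period (reps⊆S r∈reps))) r⇝x)))
          ; (there r∈reps) (there s∈reps) r⇝s → R.separated r∈reps s∈reps r⇝s
          }
      ; covers = covers
      }
      where
      module R = OrbitRepresentatives R
      x⇝ : ∀ {y} → Reaches x y → y ∈ orbit d x
      x⇝ = Equivalence.from ∈-orbit⇔′
      reps⊆S : ∀ {r} → r ∈ reps → r ∈ S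
      reps⊆S r∈reps = proj₁ (∈-removeOrbit⁻ (R.reps⊆S r∈reps))
      ∉orbit : ∀ {r} → r ∈ reps → r ∉ orbit d x
      ∉orbit r∈reps = proj₂ (∈-removeOrbit⁻ (R.reps⊆S r∈reps))
      covers : ∀ {y} → y ∈ S → Any (Reaches y) (x ∷ reps)
      covers {y} y∈S with y ∈? orbit d x
      ... | yes y∈O = here (reaches-sym (exactPeriod-fixes (period x∈S)) (Equivalence.to ∈-orbit⇔′ y∈O))
      ... | no y∉O = there (R.covers (∈-filter⁺ outside? y∈S y∉O))

  orbitRepresentatives : ∀ {d S} .{{_ : NonZero d}} → OrbitsOfPeriod d S →
    ∃[ reps ] OrbitRepresentatives S reps × length reps * d ≡ length S
  orbitRepresentatives {d} {S} = go (length S) ≤-refl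
    where
    go : ∀ n {S} → length S ≤ n → OrbitsOfPeriod d S →
         ∃[ reps ] OrbitRepresentatives S reps × length reps * d ≡ length S
    go _ {[]} _ _ = [] , record { reps⊆S = λ () ; unique = [] ; separated = λ () ; covers = λ () } , refl
    go (suc n) {x ∷ _} |S|≤1+n U
      with reps , R , |reps|*d≡|S′| ← go n (≤-pred (<-≤-trans (length-removeOrbit-< U (here refl)) |S|≤1+n))
                                        (removeOrbit-orbitsOfPeriod U (here refl)) =
      x ∷ reps , orbitRepresentatives-∷ U (here refl) R ,
      trans (cong (λ m → d + m) |reps|*d≡|S′|) (sym (length-removeOrbit U (here refl)))

  orbitRepresentatives-++ : ∀ {S₁ S₂ reps₁ reps₂} → Closed S₁ → Closed S₂ →
    (∀ {x} → x ∈ S₁ → x ∉ S₂) →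
    OrbitRepresentatives S₁ reps₁ → OrbitRepresentatives S₂ reps₂ →
    OrbitRepresentatives (S₁ ++ S₂) (reps₁ ++ reps₂)
  orbitRepresentatives-++ {S₁} {S₂} {reps₁} {reps₂} closed₁ closed₂ disjoint R₁ R₂ = record
    { reps⊆S = λ r∈ → [ ∈-++⁺ˡ ∘ R₁.reps⊆S , ∈-++⁺ʳ S₁ ∘ R₂.reps⊆S ]′ (∈-++⁻ reps₁ r∈)
    ; unique = Unique.++⁺ R₁.unique R₂.unique
                 (λ (r∈₁ , r∈₂) → disjoint (R₁.reps⊆S r∈₁) (R₂.reps⊆S r∈₂))
    ; separated = separated
    ; covers = λ y∈ → [ Any.++⁺ˡ ∘ R₁.covers , Any.++⁺ʳ reps₁ ∘ R₂.covers ]′ (∈-++⁻ S₁ y∈)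
    }
    where
    module R₁ = OrbitRepresentatives R₁
    module R₂ = OrbitRepresentatives R₂
    separated : ∀ {r s} → r ∈ reps₁ ++ reps₂ → s ∈ reps₁ ++ reps₂ → Reaches r s → r ≡ s
    separated {r} {s} r∈ s∈ (k , refl) with ∈-++⁻ reps₁ r∈ | ∈-++⁻ reps₁ s∈
    ... | inj₁ r∈₁ | inj₁ s∈₁ = R₁.separated r∈₁ s∈₁ (k , refl)
    ... | inj₂ r∈₂ | inj₂ s∈₂ = R₂.separated r∈₂ s∈₂ (k , refl)
    ... | inj₁ r∈₁ | inj₂ s∈₂ =
      ⊥-elim (disjoint (iter-closed closed₁ (R₁.reps⊆S r∈₁) k) (R₂.reps⊆S s∈₂))
    ... | inj₂ r∈₂ | inj₁ s∈₁ =
      ⊥-elim (disjoint (R₁.reps⊆S s∈₁) (iter-closed closed₂ (R₂.reps⊆S r∈₂) k))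

-- Congruence via signed divisibility, as a record so that a and b are inferable; it is equivalent to
-- _≡_[mod_] (≡mod⇔≈), which uses unsigned divisibility.
infix 4 _≈_[mod_]
record _≈_[mod_] (a b : ℤ) (n : ℕ) : Set where
  constructor ∣⇒≈
  field ≈⇒∣ : + n ℤ.∣ a ℤ.- b
open _≈_[mod_] public

≡mod⇔≈ : ∀ {a b n} → (a ≡ b [mod n ]) ⇔ (a ≈ b [mod n ])
≡mod⇔≈ = mk⇔ (λ n∣a-b → ∣⇒≈ (ℤ.∣ᵤ⇒∣ n∣a-b)) (λ a≈b → ℤ.∣⇒∣ᵤ (≈⇒∣ a≈b))

private
  ∣-resp-≡ : ∀ {k a b} → a ≡ b → k ℤ.∣ a → k ℤ.∣ b
  ∣-resp-≡ refl k∣a = k∣a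

module _ {n : ℕ} where

  ≈-refl : ∀ {a} → a ≈ a [mod n ]
  ≈-refl {a} = ∣⇒≈ (∣-resp-≡ (sym (ℤ.+-inverseʳ a)) (ℤ.∣n⇒∣m*n 0ℤ (ℤ.∣-refl {+ n})))

  ≈-sym : ∀ {a b} → a ≈ b [mod n ] → b ≈ a [mod n ]
  ≈-sym {a} {b} (∣⇒≈ n∣a-b) = ∣⇒≈ (∣-resp-≡ (neg-minus a b) (ℤ.∣m⇒∣-m n∣a-b))
    where
    neg-minus : ∀ a b → ℤ.- (a ℤ.- b) ≡ b ℤ.- a
    neg-minus = solve-∀

  ≈-trans : ∀ {a b c} → a ≈ b [mod n ] → b ≈ c [mod n ] → a ≈ c [mod n ]
  ≈-trans {a} {b} {c} (∣⇒≈ n∣a-b) (∣⇒≈ n∣b-c) =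
    ∣⇒≈ (∣-resp-≡ (telescope a b c) (ℤ.∣m∣n⇒∣m+n n∣a-b n∣b-c))
    where
    telescope : ∀ a b c → (a ℤ.- b) ℤ.+ (b ℤ.- c) ≡ a ℤ.- c
    telescope = solve-∀

  ≈-reflexive : ∀ {a b} → a ≡ b → a ≈ b [mod n ]
  ≈-reflexive refl = ≈-refl

  *-congˡ-≈ : ∀ c {a b} → a ≈ b [mod n ] → c ℤ.* a ≈ c ℤ.* b [mod n ]
  *-congˡ-≈ c {a} {b} (∣⇒≈ n∣a-b) = ∣⇒≈ (∣-resp-≡ (distrib c a b) (ℤ.∣n⇒∣m*n c n∣a-b))
    where
    distrib : ∀ c a b → c ℤ.* (a ℤ.- b) ≡ c ℤ.* a ℤ.- c ℤ.* b
    distrib = solve-∀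

  *-congʳ-≈ : ∀ c {a b} → a ≈ b [mod n ] → a ℤ.* c ≈ b ℤ.* c [mod n ]
  *-congʳ-≈ c {a} {b} a≈b = subst₂ (_≈_[mod n ]) (ℤ.*-comm c a) (ℤ.*-comm c b) (*-congˡ-≈ c a≈b)

  ∣⇔≈0 : ∀ {x} → n ∣ x ⇔ (+ x ≈ 0ℤ [mod n ])
  ∣⇔≈0 {x} = mk⇔ (λ n∣x → ∣⇒≈ (∣-resp-≡ (sym (ℤ.+-identityʳ (+ x))) (ℤ.∣ᵤ⇒∣ n∣x)))
                 (λ x≈0 → subst (n ∣_) (cong ℤ.∣_∣ (ℤ.+-identityʳ (+ x))) (ℤ.∣⇒∣ᵤ (≈⇒∣ x≈0)))

  %ℕ-≈ : .{{_ : NonZero n}} → ∀ a → + (a %ℕ n) ≈ a [mod n ]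
  %ℕ-≈ a = ∣⇒≈ (ℤ.divides (ℤ.- (a /ℕ n))
    (trans (cong (λ z → + (a %ℕ n) ℤ.- z) (a≡a%ℕn+[a/ℕn]*n a n)) (cancel (+ (a %ℕ n)) (a /ℕ n) (+ n))))
    where
    cancel : ∀ r q n → r ℤ.- (r ℤ.+ q ℤ.* n) ≡ (ℤ.- q) ℤ.* n
    cancel = solve-∀

  private
    multiple-below⇒0 : ∀ {m} → m < n → n ∣ m → m ≡ 0
    multiple-below⇒0 {zero} _ _ = refl
    multiple-below⇒0 {suc _} m<n n∣m = ⊥-elim (>⇒∤ m<n n∣m)

    ≈∧≤⇒≥ : ∀ {u v} → u ≤ v → v < n → + u ≈ + v [mod n ] → v ≤ u
    ≈∧≤⇒≥ {u} {v} u≤v v<n (∣⇒≈ n∣u-v) =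
      m∸n≡0⇒m≤n (multiple-below⇒0 (≤-<-trans (m∸n≤m v u) v<n) n∣v∸u)
      where
      n∣v∸u : n ∣ v ∸ u
      n∣v∸u = subst (n ∣_) (trans (cong ℤ.∣_∣ (ℤ.m-n≡m⊖n u v)) (ℤ.∣⊖∣-≤ u≤v))
                    (ℤ.∣⇒∣ᵤ n∣u-v)

  ≈⇒≡ : ∀ {y z} → y < n → z < n → + y ≈ + z [mod n ] → y ≡ z
  ≈⇒≡ {y} {z} y<n z<n y≈z with ≤-total y z
  ... | inj₁ y≤z = ≤-antisym y≤z (≈∧≤⇒≥ y≤z z<n y≈z)
  ... | inj₂ z≤y = ≤-antisym (≈∧≤⇒≥ z≤y y<n (≈-sym y≈z)) z≤y

≈-setoid : ℕ → Setoid 0ℓ 0ℓ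
≈-setoid n = record
  { Carrier = ℤ
  ; _≈_ = _≈_[mod n ]
  ; isEquivalence = record { refl = ≈-refl ; sym = ≈-sym ; trans = ≈-trans }
  }

module ≈-Reasoning (n : ℕ) = SetoidReasoning (≈-setoid n)

≈-mod-∣ : ∀ {m n a b} → m ∣ n → a ≈ b [mod n ] → a ≈ b [mod m ]
≈-mod-∣ m∣n (∣⇒≈ n∣a-b) = ∣⇒≈ (ℤ.∣-trans (ℤ.∣ᵤ⇒∣ m∣n) n∣a-b)

≈-mod-* : ∀ {m n a b} → Coprime m n → a ≈ b [mod m ] → a ≈ b [mod n ] → a ≈ b [mod m * n ]
≈-mod-* {m} {n} coprime (∣⇒≈ m∣a-b) (∣⇒≈ n∣a-b) =
  ∣⇒≈ (ℤ.∣ᵤ⇒∣ (subst (_∣ _) lcm≡m*n (lcm-least (ℤ.∣⇒∣ᵤ m∣a-b) (ℤ.∣⇒∣ᵤ n∣a-b))))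
  where
  lcm≡m*n : lcm m n ≡ m * n
  lcm≡m*n = trans (sym (*-identityˡ (lcm m n)))
                  (subst (λ g → g * lcm m n ≡ m * n) (coprime⇒gcd≡1 coprime) (gcd*lcm m n))

≈-mod-*⇔ : ∀ {m n o a b} → Coprime m n → m * n ≡ o →
  (a ≈ b [mod o ]) ⇔ ((a ≈ b [mod m ]) × (a ≈ b [mod n ]))
≈-mod-*⇔ {m} {n} coprime refl = mk⇔ (λ a≈b → ≈-mod-∣ (m∣m*n n) a≈b , ≈-mod-∣ (n∣m*n m) a≈b)
                                    (λ (a≈b , a≈b′) → ≈-mod-* coprime a≈b a≈b′)

euclidsLemmaℤ : ∀ {s} → Prime s → ∀ a b → + s ℤ.∣ a ℤ.* b → (+ s ℤ.∣ a) ⊎ (+ s ℤ.∣ b)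
euclidsLemmaℤ {s} s-prime a b s∣ab =
  Sum.map ℤ.∣ᵤ⇒∣ ℤ.∣ᵤ⇒∣
    (euclidsLemma ℤ.∣ a ∣ ℤ.∣ b ∣ s-prime (subst (s ∣_) (ℤ.abs-* a b) (ℤ.∣⇒∣ᵤ s∣ab)))

≈-cancelʳ-prime : ∀ {s c a b} → Prime s → ¬ (+ s ℤ.∣ c) →
  a ℤ.* c ≈ b ℤ.* c [mod s ] → a ≈ b [mod s ]
≈-cancelʳ-prime {s} {c} {a} {b} s-prime s∤c (∣⇒≈ s∣ac-bc) =
  [ ∣⇒≈ , ⊥-elim ∘ s∤c ]′ (euclidsLemmaℤ s-prime (a ℤ.- b) c (∣-resp-≡ (factor a b c) s∣ac-bc))
  where
  factor : ∀ a b c → a ℤ.* c ℤ.- b ℤ.* c ≡ (a ℤ.- b) ℤ.* c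
  factor = solve-∀

*-≈-self-if-∣ : ∀ {r x} a → r ∣ x → a ℤ.* + x ≈ + x [mod r ]
*-≈-self-if-∣ {r} {x} a r∣x = begin
  a ℤ.* + x   ≈⟨ *-congˡ-≈ a x≈0 ⟩
  a ℤ.* 0ℤ    ≡⟨ ℤ.*-zeroʳ a ⟩
  0ℤ          ≈⟨ x≈0 ⟨
  + x         ∎
  where
  open ≈-Reasoning r
  x≈0 : + x ≈ 0ℤ [mod r ]
  x≈0 = Equivalence.to ∣⇔≈0 r∣x

*-≈-self⇔ : ∀ {s x} a → Prime s → ¬ s ∣ x → (a ℤ.* + x ≈ + x [mod s ]) ⇔ (a ≈ 1ℤ [mod s ])
*-≈-self⇔ {s} {x} a s-prime s∤x = mk⇔
  (λ ax≈x → ≈-cancelʳ-prime s-prime (λ s∣x → s∤x (ℤ.∣⇒∣ᵤ s∣x))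
              (≈-trans ax≈x (≈-reflexive (sym (ℤ.*-identityˡ (+ x))))))
  (λ a≈1 → ≈-trans (*-congʳ-≈ (+ x) a≈1) (≈-reflexive (ℤ.*-identityˡ (+ x))))

module MultiplicationMap (N : ℕ) .{{_ : NonZero N}} (α : ℤ) where

  f : ℕ → ℕ
  f x = (α ℤ.* + x) %ℕ N

  open Orbits f public

  f<N : ∀ x → f x < N
  f<N x = n%ℕd<d (α ℤ.* + x) N

  iter<N : ∀ {x} → x < N → ∀ k → iter k x < N
  iter<N x<N zero = x<N
  iter<N x<N (suc k) = f<N _

  iter-≈ : ∀ k x → + iter k x ≈ α ℤ.^ k ℤ.* + x [mod N ]
  iter-≈ zero x = ≈-reflexive (sym (ℤ.*-identityˡ (+ x)))
  iter-≈ (suc k) x = begin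
    + f (iter k x)                 ≈⟨ %ℕ-≈ (α ℤ.* + iter k x) ⟩
    α ℤ.* + iter k x               ≈⟨ *-congˡ-≈ α (iter-≈ k x) ⟩
    α ℤ.* (α ℤ.^ k ℤ.* + x)        ≡⟨ ℤ.*-assoc α (α ℤ.^ k) (+ x) ⟨
    α ℤ.^ suc k ℤ.* + x            ∎
    where open ≈-Reasoning N

  iter-fixed⇔ : ∀ {x} → x < N → ∀ k → iter k x ≡ x ⇔ (α ℤ.^ k ℤ.* + x ≈ + x [mod N ])
  iter-fixed⇔ {x} x<N k = mk⇔
    (λ fixed → ≈-trans (≈-sym (iter-≈ k x)) (≈-reflexive (cong +_ fixed)))
    (λ αᵏx≈x → ≈⇒≡ (iter<N x<N k) x<N (≈-trans (iter-≈ k x) αᵏx≈x))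

  reaches⇔inOrbit : ∀ {x y} → x < N → Reaches x y ⇔ InOrbit N α x y
  reaches⇔inOrbit {x} {y} x<N = mk⇔
    (λ { (k , refl) → iter<N x<N k , k , Equivalence.from ≡mod⇔≈ (iter-≈ k x) })
    (λ (y<N , k , y≡αᵏx) → k , ≈⇒≡ (iter<N x<N k) y<N
       (≈-trans (iter-≈ k x) (≈-sym (Equivalence.to (≡mod⇔≈ {b = α ℤ.^ k ℤ.* + x}) y≡αᵏx))))

  edge⇒≡f : ∀ {i j} → Edge N α i j → j ≡ f i
  edge⇒≡f {i} (_ , (_ , j<N) , j≡αi) =
    ≈⇒≡ j<N (f<N i) (≈-trans (Equivalence.to (≡mod⇔≈ {b = α ℤ.* + i}) j≡αi) (≈-sym (%ℕ-≈ _)))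

  module Connectivity
    (f-vertex : ∀ {x} → IsVertex N x → IsVertex N (f x))
    (periodic : ∀ {x} → IsVertex N x → ∃[ t ] iter (suc t) x ≡ x) where

    connected⇒reaches : ∀ {v w} → Connected N α v w → Reaches v w
    connected⇒reaches ε = 0 , refl
    connected⇒reaches (fwd e ◅ path) = reaches-trans (1 , sym (edge⇒≡f e)) (connected⇒reaches path)
    connected⇒reaches (bwd e@(u-vertex , _) ◅ path) with t , fixed ← periodic u-vertex =
      reaches-trans (reaches-sym {suc t} fixed (1 , sym (edge⇒≡f e))) (connected⇒reaches path)

    iter-vertex : ∀ {v} → IsVertex N v → ∀ k → IsVertex N (iter k v)
    iter-vertex v-vertex zero = v-vertex
    iter-vertex v-vertex (suc k) = f-vertex (iter-vertex v-vertex k)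

    reaches⇒connected : ∀ {v w} → IsVertex N v → Reaches v w → Connected N α v w
    reaches⇒connected {v} v-vertex (zero , refl) = ε
    reaches⇒connected {v} v-vertex (suc k , refl) =
      reaches⇒connected v-vertex (k , refl) ◅◅
      (fwd (iter-vertex v-vertex k , iter-vertex v-vertex (suc k) ,
            Equivalence.from ≡mod⇔≈ (%ℕ-≈ (α ℤ.* + iter k v))) ◅ ε)

    numComponents-of-representatives : ∀ {S c} → (∀ {x} → x ∈ S ⇔ IsVertex N x) →
      ∃[ reps ] OrbitRepresentatives S reps × length reps ≡ c → NumComponents N α c
    numComponents-of-representatives ∈S⇔ (reps , R , refl) =
      reps , refl , (λ r r∈ → Equivalence.to ∈S⇔ (R.reps⊆S r∈)) , R.unique ,
      (λ r s r∈ s∈ → R.separated r∈ s∈ ∘ connected⇒reaches) ,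
      (λ v v-vertex → Any.map (reaches⇒connected v-vertex) (R.covers (Equivalence.from ∈S⇔ v-vertex)))
      where module R = OrbitRepresentatives R

suc<⇔<∸1 : ∀ {j s} → suc j < s ⇔ j < s ∸ 1
suc<⇔<∸1 {s = zero} = mk⇔ (λ ()) (λ ())
suc<⇔<∸1 {s = suc s} = mk⇔ <-pred s<s

lcm-∣⇔ : ∀ {m n k} → (m ∣ k × n ∣ k) ⇔ lcm m n ∣ k
lcm-∣⇔ {m} {n} = mk⇔ (λ (m∣k , n∣k) → lcm-least m∣k n∣k)
                     (λ lcm∣k → ∣-trans (m∣lcm[m,n] m n) lcm∣k , ∣-trans (n∣lcm[m,n] m n) lcm∣k)

m*n≡o⇒o-div-n≡m : ∀ m n {o} .{{_ : NonZero n}} → m * n ≡ o → o div n ≡ m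
m*n≡o⇒o-div-n≡m m (suc n) refl = m*n/n≡m m (suc n)

prime>1 : ∀ {r} → Prime r → 1 < r
prime>1 {r} r-prime = nonTrivial⇒n>1 r {{prime⇒nonTrivial r-prime}}

distinct-primes-coprime : ∀ {r s} → Prime r → Prime s → r ≢ s → Coprime r s
distinct-primes-coprime r-prime s-prime r≢s (i∣r , i∣s) with prime⇒irreducible r-prime i∣r
... | inj₁ i≡1 = i≡1
... | inj₂ refl with prime⇒irreducible s-prime i∣s
...   | inj₁ r≡1 = r≡1
...   | inj₂ r≡s = ⊥-elim (r≢s r≡s)

module TwoPrimes (p q : ℕ) (p-prime : Prime p) (q-prime : Prime q) (p≢q : p ≢ q)
                 (α : ℤ) (α-coprime : gcd α (+ (p * q)) ≡ + 1) where

  N : ℕ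
  N = p * q

  instance
    N≢0 : NonZero N
    N≢0 = m*n≢0 p q {{prime⇒nonZero p-prime}} {{prime⇒nonZero q-prime}}

  open MultiplicationMap N α

  Order : ℕ → ℕ → Set
  Order s d = ∀ k → (α ℤ.^ k ≈ 1ℤ [mod s ]) ⇔ d ∣ k

  prime∤α : ∀ {r} → Prime r → r ∣ N → ¬ (+ r ℤ.∣ α)
  prime∤α r-prime r∣N r∣α = <⇒≢ (prime>1 r-prime)
    (sym (∣1⇒≡1 (subst (_ ∣_) (ℤ.+-injective α-coprime) (ℕ.gcd-greatest (ℤ.∣⇒∣ᵤ r∣α) r∣N))))

  ∣-f⇔ : ∀ {r x} → Prime r → r ∣ N → r ∣ f x ⇔ r ∣ x
  ∣-f⇔ {r} {x} r-prime r∣N = mk⇔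
    (λ r∣fx → Equivalence.from ∣⇔≈0 (≈-cancelʳ-prime r-prime (prime∤α r-prime r∣N) (begin
      + x ℤ.* α     ≡⟨ ℤ.*-comm (+ x) α ⟩
      α ℤ.* + x     ≈⟨ fx≈αx ⟨
      + f x         ≈⟨ Equivalence.to ∣⇔≈0 r∣fx ⟩
      0ℤ            ≡⟨ ℤ.*-zeroˡ α ⟨
      0ℤ ℤ.* α      ∎)))
    (λ r∣x → Equivalence.from ∣⇔≈0 (begin
      + f x         ≈⟨ fx≈αx ⟩
      α ℤ.* + x     ≈⟨ *-congˡ-≈ α (Equivalence.to ∣⇔≈0 r∣x) ⟩
      α ℤ.* 0ℤ      ≡⟨ ℤ.*-zeroʳ α ⟩
      0ℤ            ∎))
    where
    open ≈-Reasoning r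
    fx≈αx : + f x ≈ α ℤ.* + x [mod r ]
    fx≈αx = ≈-mod-∣ r∣N (%ℕ-≈ (α ℤ.* + x))

  module MultiplesOf (r s : ℕ) (r-prime : Prime r) (s-prime : Prime s) (r≢s : r ≢ s)
                     (r*s≡N : r * s ≡ N) where

    private
      instance
        r≢0 : NonZero r
        r≢0 = prime⇒nonZero r-prime

      r∣N : r ∣ N
      r∣N = divides s (trans (sym r*s≡N) (*-comm r s))

      s∣N : s ∣ N
      s∣N = divides r (sym r*s≡N)

      r⊥s : Coprime r s
      r⊥s = distinct-primes-coprime r-prime s-prime r≢s

      s∤r : ¬ s ∣ r
      s∤r s∣r = <⇒≢ (prime>1 s-prime) (sym (r⊥s (s∣r , ∣-refl)))

    iter-fixed⇔-mod-factors : ∀ {x} → x < N → ∀ k →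
      iter k x ≡ x ⇔ ((α ℤ.^ k ℤ.* + x ≈ + x [mod r ]) × (α ℤ.^ k ℤ.* + x ≈ + x [mod s ]))
    iter-fixed⇔-mod-factors x<N k = ⇔.trans (iter-fixed⇔ x<N k) (≈-mod-*⇔ r⊥s r*s≡N)

    multiples : List ℕ
    multiples = applyUpTo (λ j → r * suc j) (s ∸ 1)

    ∈-multiples⁻ : ∀ {x} → x ∈ multiples → IsVertex N x × r ∣ x × ¬ s ∣ x
    ∈-multiples⁻ x∈ with j , j<s∸1 , refl ← ∈-applyUpTo⁻ (λ j → r * suc j) x∈ =
      (≤-trans (<⇒≤ (prime>1 r-prime)) (m≤m*n r (suc j)) , subst (r * suc j <_) r*s≡N (*-monoʳ-< r 1+j<s)) ,
      m∣m*n (suc j) ,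
      λ s∣r[1+j] → [ s∤r , <⇒≱ 1+j<s ∘ ∣⇒≤ ]′ (euclidsLemma r (suc j) s-prime s∣r[1+j])
      where
      1+j<s : suc j < s
      1+j<s = Equivalence.from suc<⇔<∸1 j<s∸1

    ∈-multiples⁺ : ∀ {x} → IsVertex N x → r ∣ x → ¬ s ∣ x → x ∈ multiples
    ∈-multiples⁺ (() , _) (divides zero refl) _
    ∈-multiples⁺ (_ , x<N) (divides (suc j) refl) _ =
      subst (_∈ multiples) (*-comm r (suc j))
        (∈-applyUpTo⁺ (λ j → r * suc j) (Equivalence.to suc<⇔<∸1 1+j<s))
      where
      1+j<s : suc j < s
      1+j<s = *-cancelˡ-< r (suc j) s (subst₂ _<_ (*-comm (suc j) r) (sym r*s≡N) x<N)

    multiples-unique : Unique multiples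
    multiples-unique = Unique.applyUpTo⁺₁ (λ j → r * suc j) (s ∸ 1) λ {i} {j} i<j _ r[1+i]≡r[1+j] →
      <⇒≢ i<j (suc-injective (*-cancelˡ-≡ (suc i) (suc j) r r[1+i]≡r[1+j]))

    multiples-closed : Closed multiples
    multiples-closed {x} x∈ with _ , r∣x , s∤x ← ∈-multiples⁻ x∈ =
      ∈-multiples⁺ (n≢0⇒n>0 fx≢0 , f<N x) (Equivalence.from (∣-f⇔ r-prime r∣N) r∣x) s∤fx
      where
      s∤fx : ¬ s ∣ f x
      s∤fx = s∤x ∘ Equivalence.to (∣-f⇔ s-prime s∣N)
      fx≢0 : f x ≢ 0
      fx≢0 fx≡0 = s∤fx (subst (s ∣_) (sym fx≡0) (s ∣0))

    multiples-fixed⇔ : ∀ {x} → x ∈ multiples → ∀ k → iter k x ≡ x ⇔ (α ℤ.^ k ≈ 1ℤ [mod s ])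
    multiples-fixed⇔ x∈ k with (_ , x<N) , r∣x , s∤x ← ∈-multiples⁻ x∈ =
      ⇔.trans (iter-fixed⇔-mod-factors x<N k)
        (⇔.trans (mk⇔ proj₂ (*-≈-self-if-∣ (α ℤ.^ k) r∣x ,_)) (*-≈-self⇔ (α ℤ.^ k) s-prime s∤x))

    multiples-orbitsOfPeriod : ∀ {d} → Order s d → OrbitsOfPeriod d multiples
    multiples-orbitsOfPeriod order = record
      { unique = multiples-unique
      ; closed = multiples-closed
      ; period = λ x∈ k → ⇔.trans (multiples-fixed⇔ x∈ k) (order k)
      }

    private
      r∈multiples : r ∈ multiples
      r∈multiples = ∈-multiples⁺ (<⇒≤ (prime>1 r-prime) , r<N) ∣-refl s∤r
        where
        r<N : r < N
        r<N = subst₂ _<_ (*-identityʳ r) r*s≡N (*-monoʳ-< r (prime>1 s-prime))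

      r-periodic : (l : List ℕ) → (∀ k → iter k r ∈ l) → ∃[ t ] iter (suc t) r ≡ r
      r-periodic l iter∈l with i , j , i<j , iᵗʰ≡jᵗʰ ← orbit-repeats l iter∈l =
        j ∸ suc i , subst (λ k → iter k r ≡ r) (+-∸-assoc 1 i<j)
                      (Equivalence.from (multiples-fixed⇔ r∈multiples (j ∸ i))
                        (Equivalence.to (multiples-fixed⇔ (iter-closed multiples-closed r∈multiples i) (j ∸ i))
                          shifted))
        where
        shifted : iter (j ∸ i) (iter i r) ≡ iter i r
        shifted = trans (sym (iter-+ (j ∸ i) i r))
                        (trans (cong (λ k → iter k r) (m∸n+n≡m (<⇒≤ i<j))) (sym iᵗʰ≡jᵗʰ))

    order-from-card : ∀ {m} → HasCard (InOrbit N α r) m → NonZero m × Order s m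
    order-from-card (l , refl , l-unique , ∈l⇔) = order (exactPeriod-exists (r-periodic l iter∈l))
      where
      ∈l⇔reaches : ∀ {y} → y ∈ l ⇔ Reaches r y
      ∈l⇔reaches {y} =
        ⇔.trans (∈l⇔ y) (⇔.sym (reaches⇔inOrbit (proj₂ (proj₁ (∈-multiples⁻ r∈multiples)))))
      iter∈l : ∀ k → iter k r ∈ l
      iter∈l k = Equivalence.from ∈l⇔reaches (k , refl)
      order : ∃[ e ] ExactPeriod (suc e) r → NonZero (length l) × Order s (length l)
      order (e , period) rewrite exactPeriod≡card period l-unique (λ _ → ∈l⇔reaches) =
        _ , λ k → ⇔.trans (⇔.sym (multiples-fixed⇔ r∈multiples k)) (period k)

  module P = MultiplesOf p q p-prime q-prime p≢q refl
  module Q = MultiplesOf q p q-prime p-prime (p≢q ∘ sym) (*-comm q p)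

  vertices : List ℕ
  vertices = applyUpTo suc (N ∸ 1)

  ∈-vertices⇔ : ∀ {x} → x ∈ vertices ⇔ IsVertex N x
  ∈-vertices⇔ = mk⇔ to from
    where
    to : ∀ {x} → x ∈ vertices → IsVertex N x
    to x∈ with i , i<N∸1 , refl ← ∈-applyUpTo⁻ suc x∈ = s≤s z≤n , Equivalence.from suc<⇔<∸1 i<N∸1
    from : ∀ {x} → IsVertex N x → x ∈ vertices
    from {suc i} (_ , x<N) = ∈-applyUpTo⁺ suc (Equivalence.to suc<⇔<∸1 x<N)

  vertices-unique : Unique vertices
  vertices-unique = Unique.applyUpTo⁺₁ suc (N ∸ 1) (λ i<j _ → <⇒≢ i<j ∘ suc-injective)

  coprime-to-p-q? : ∀ x → Dec (¬ p ∣ x × ¬ q ∣ x)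
  coprime-to-p-q? x = ¬? (p ∣? x) ×-dec ¬? (q ∣? x)

  units : List ℕ
  units = filter coprime-to-p-q? vertices

  ∈-units⁻ : ∀ {x} → x ∈ units → IsVertex N x × ¬ p ∣ x × ¬ q ∣ x
  ∈-units⁻ x∈ with x∈V , p∤x , q∤x ← ∈-filter⁻ coprime-to-p-q? x∈ =
    Equivalence.to ∈-vertices⇔ x∈V , p∤x , q∤x

  ∈-units⁺ : ∀ {x} → IsVertex N x → ¬ p ∣ x → ¬ q ∣ x → x ∈ units
  ∈-units⁺ x-vertex p∤x q∤x =
    ∈-filter⁺ coprime-to-p-q? (Equivalence.from ∈-vertices⇔ x-vertex) (p∤x , q∤x)

  units-unique : Unique units
  units-unique = Unique.filter⁺ coprime-to-p-q? vertices-unique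

  units-closed : Closed units
  units-closed {x} x∈ with x-vertex , p∤x , q∤x ← ∈-units⁻ x∈ =
    ∈-units⁺ (n≢0⇒n>0 fx≢0 , f<N x) p∤fx q∤fx
    where
    p∤fx : ¬ p ∣ f x
    p∤fx = p∤x ∘ Equivalence.to (∣-f⇔ p-prime (m∣m*n q))
    q∤fx : ¬ q ∣ f x
    q∤fx = q∤x ∘ Equivalence.to (∣-f⇔ q-prime (n∣m*n p))
    fx≢0 : f x ≢ 0
    fx≢0 fx≡0 = p∤fx (subst (p ∣_) (sym fx≡0) (p ∣0))

  units-fixed⇔ : ∀ {x} → x ∈ units → ∀ k →
    iter k x ≡ x ⇔ ((α ℤ.^ k ≈ 1ℤ [mod q ]) × (α ℤ.^ k ≈ 1ℤ [mod p ]))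
  units-fixed⇔ x∈ k with (_ , x<N) , p∤x , q∤x ← ∈-units⁻ x∈ =
    ⇔.trans (Q.iter-fixed⇔-mod-factors x<N k)
      (*-≈-self⇔ (α ℤ.^ k) q-prime q∤x ×-⇔ *-≈-self⇔ (α ℤ.^ k) p-prime p∤x)

  units-orbitsOfPeriod : ∀ {m n} → Order q m → Order p n → OrbitsOfPeriod (lcm m n) units
  units-orbitsOfPeriod q-order p-order = record
    { unique = units-unique
    ; closed = units-closed
    ; period = λ x∈ k → ⇔.trans (units-fixed⇔ x∈ k) (⇔.trans (q-order k ×-⇔ p-order k) lcm-∣⇔)
    }

  vertex-not-p∣∧q∣ : ∀ {x} → IsVertex N x → p ∣ x → q ∣ x → ⊥
  vertex-not-p∣∧q∣ {x} (1≤x , x<N) p∣x q∣x = <⇒≢ 1≤x (sym (≈⇒≡ x<N (>-nonZero⁻¹ N) x≈0))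
    where
    x≈0 : + x ≈ 0ℤ [mod p * q ]
    x≈0 = ≈-mod-* (distinct-primes-coprime p-prime q-prime p≢q)
                  (Equivalence.to ∣⇔≈0 p∣x) (Equivalence.to ∣⇔≈0 q∣x)

  classes : List ℕ
  classes = P.multiples ++ (Q.multiples ++ units)

  Q∉units : ∀ {x} → x ∈ Q.multiples → x ∉ units
  Q∉units x∈Q x∈U with _ , q∣x , _ ← Q.∈-multiples⁻ x∈Q | _ , _ , q∤x ← ∈-units⁻ x∈U =
    q∤x q∣x

  P∉Q++units : ∀ {x} → x ∈ P.multiples → x ∉ Q.multiples ++ units
  P∉Q++units x∈P x∈ with _ , p∣x , _ ← P.∈-multiples⁻ x∈P | ∈-++⁻ Q.multiples x∈
  ... | inj₁ x∈Q = proj₂ (proj₂ (Q.∈-multiples⁻ x∈Q)) p∣x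
  ... | inj₂ x∈U = proj₁ (proj₂ (∈-units⁻ x∈U)) p∣x

  ∈-classes⇔ : ∀ {x} → x ∈ classes ⇔ IsVertex N x
  ∈-classes⇔ = mk⇔ to from
    where
    to : ∀ {x} → x ∈ classes → IsVertex N x
    to x∈ with ∈-++⁻ P.multiples x∈
    ... | inj₁ x∈P = proj₁ (P.∈-multiples⁻ x∈P)
    ... | inj₂ x∈Q++U with ∈-++⁻ Q.multiples x∈Q++U
    ...   | inj₁ x∈Q = proj₁ (Q.∈-multiples⁻ x∈Q)
    ...   | inj₂ x∈U = proj₁ (∈-units⁻ x∈U)
    from : ∀ {x} → IsVertex N x → x ∈ classes
    from {x} x-vertex with p ∣? x | q ∣? x
    ... | yes p∣x | yes q∣x = ⊥-elim (vertex-not-p∣∧q∣ x-vertex p∣x q∣x)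
    ... | yes p∣x | no q∤x = ∈-++⁺ˡ (P.∈-multiples⁺ x-vertex p∣x q∤x)
    ... | no p∤x | yes q∣x = ∈-++⁺ʳ P.multiples (∈-++⁺ˡ (Q.∈-multiples⁺ x-vertex q∣x p∤x))
    ... | no p∤x | no q∤x = ∈-++⁺ʳ P.multiples (∈-++⁺ʳ Q.multiples (∈-units⁺ x-vertex p∤x q∤x))

  classes-unique : Unique classes
  classes-unique = Unique.++⁺ P.multiples-unique
    (Unique.++⁺ Q.multiples-unique units-unique (λ (x∈Q , x∈U) → Q∉units x∈Q x∈U))
    (λ (x∈P , x∈Q++U) → P∉Q++units x∈P x∈Q++U)

  classes-closed : Closed classes
  classes-closed = closed-++ P.multiples-closed (closed-++ Q.multiples-closed units-closed)

  length-units : length units ≡ (p ∸ 1) * (q ∸ 1)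
  length-units = complement-count (prime⇒nonZero p-prime) (prime⇒nonZero q-prime) (begin
    p * q ∸ 1                                           ≡⟨ length-applyUpTo suc (N ∸ 1) ⟨
    length vertices                                     ≡⟨ length-unique-≡ vertices-unique classes-unique
                                                             (from ∈-classes⇔ ∘ to ∈-vertices⇔)
                                                             (from ∈-vertices⇔ ∘ to ∈-classes⇔) ⟩
    length classes                                      ≡⟨ length-++ P.multiples ⟩
    length P.multiples + length (Q.multiples ++ units)  ≡⟨ cong₂ _+_ (length-applyUpTo _ (q ∸ 1))
                                                                      (length-++ Q.multiples) ⟩
    (q ∸ 1) + (length Q.multiples + length units)       ≡⟨ cong (λ n → (q ∸ 1) + (n + length units))
                                                                 (length-applyUpTo _ (p ∸ 1)) ⟩
    (q ∸ 1) + ((p ∸ 1) + length units)                  ∎)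
    where
    open ≡-Reasoning
    open Equivalence using (to; from)
    complement-count : ∀ {a b c} → NonZero a → NonZero b →
      a * b ∸ 1 ≡ (b ∸ 1) + ((a ∸ 1) + c) → c ≡ (a ∸ 1) * (b ∸ 1)
    complement-count {suc a} {suc b} _ _ ab∸1≡ =
      +-cancelˡ-≡ a _ _ (trans (+-cancelˡ-≡ b _ _ (sym ab∸1≡)) (*-suc a b))

  module _ {mp mq} (p-card : HasCard (InOrbit N α p) mp) (q-card : HasCard (InOrbit N α q) mq) where

    private
      instance
        mp≢0 : NonZero mp
        mp≢0 = proj₁ (P.order-from-card p-card)
        mq≢0 : NonZero mq
        mq≢0 = proj₁ (Q.order-from-card q-card)
        lcm≢0 : NonZero (lcm mp mq)
        lcm≢0 = m*n≢0⇒n≢0 (ℕ.gcd mp mq) {{subst NonZero (sym (gcd*lcm mp mq)) (m*n≢0 mp mq)}}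

      P-orbits : OrbitsOfPeriod mp P.multiples
      P-orbits = P.multiples-orbitsOfPeriod (proj₂ (P.order-from-card p-card))
      Q-orbits : OrbitsOfPeriod mq Q.multiples
      Q-orbits = Q.multiples-orbitsOfPeriod (proj₂ (Q.order-from-card q-card))
      U-orbits : OrbitsOfPeriod (lcm mp mq) units
      U-orbits = units-orbitsOfPeriod (proj₂ (P.order-from-card p-card)) (proj₂ (Q.order-from-card q-card))

      vertex-periodic : ∀ {x} → IsVertex N x → ∃[ t ] iter (suc t) x ≡ x
      vertex-periodic x-vertex with ∈-++⁻ P.multiples (Equivalence.from ∈-classes⇔ x-vertex)
      ... | inj₁ x∈P = exactPeriod⇒periodic (OrbitsOfPeriod.period P-orbits x∈P)
      ... | inj₂ x∈Q++U with ∈-++⁻ Q.multiples x∈Q++U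
      ...   | inj₁ x∈Q = exactPeriod⇒periodic (OrbitsOfPeriod.period Q-orbits x∈Q)
      ...   | inj₂ x∈U = exactPeriod⇒periodic (OrbitsOfPeriod.period U-orbits x∈U)

      f-vertex : ∀ {x} → IsVertex N x → IsVertex N (f x)
      f-vertex = Equivalence.to ∈-classes⇔ ∘ classes-closed ∘ Equivalence.from ∈-classes⇔

      open Connectivity f-vertex vertex-periodic

      component-count : ℕ
      component-count = ((q ∸ 1) div mp) + ((p ∸ 1) div mq) + (((p ∸ 1) * (q ∸ 1)) div (lcm mp mq))

      length-representatives : (repsP repsQ repsU : List ℕ) → length repsP * mp ≡ length P.multiples →
        length repsQ * mq ≡ length Q.multiples → length repsU * lcm mp mq ≡ length units →
        length (repsP ++ (repsQ ++ repsU)) ≡ component-count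
      length-representatives repsP repsQ repsU |repsP|*mp |repsQ|*mq |repsU|*lcm = begin
        length (repsP ++ (repsQ ++ repsU))             ≡⟨ length-++ repsP ⟩
        length repsP + length (repsQ ++ repsU)         ≡⟨ cong (λ n → length repsP + n) (length-++ repsQ) ⟩
        length repsP + (length repsQ + length repsU)   ≡⟨ +-assoc (length repsP) _ _ ⟨
        length repsP + length repsQ + length repsU
          ≡⟨ cong₂ _+_ (cong₂ _+_ (m*n≡o⇒o-div-n≡m (length repsP) mp |repsP|*mp)
                                  (m*n≡o⇒o-div-n≡m (length repsQ) mq |repsQ|*mq))
                       (m*n≡o⇒o-div-n≡m (length repsU) (lcm mp mq) |repsU|*lcm) ⟨
        length P.multiples div mp + length Q.multiples div mq + length units div lcm mp mq
          ≡⟨ cong₂ _+_ (cong₂ _+_ (cong (_div mp) (length-applyUpTo _ (q ∸ 1)))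
                                  (cong (_div mq) (length-applyUpTo _ (p ∸ 1))))
                       (cong (_div lcm mp mq) length-units) ⟩
        component-count
          ∎
        where open ≡-Reasoning

      classRepresentatives : ∃[ reps ] OrbitRepresentatives classes reps × length reps ≡ component-count
      classRepresentatives
        with repsP , RP , |repsP|*mp ← orbitRepresentatives P-orbits
           | repsQ , RQ , |repsQ|*mq ← orbitRepresentatives Q-orbits
           | repsU , RU , |repsU|*lcm ← orbitRepresentatives U-orbits =
        repsP ++ (repsQ ++ repsU) ,
        orbitRepresentatives-++ P.multiples-closed (closed-++ Q.multiples-closed units-closed) P∉Q++units RP
          (orbitRepresentatives-++ Q.multiples-closed units-closed Q∉units RQ RU) ,
        length-representatives repsP repsQ repsU |repsP|*mp |repsQ|*mq |repsU|*lcm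

    numComponents : NumComponents N α component-count
    numComponents = numComponents-of-representatives ∈-classes⇔ classRepresentatives

theorem1 : (p q : ℕ) → Prime p → Prime q → p ≢ q →
    (α : ℤ) → gcd α (+ (p * q)) ≡ + 1 →
    (mp mq : ℕ) →
    HasCard (InOrbit (p * q) α p) mp →
    HasCard (InOrbit (p * q) α q) mq →
    NumComponents (p * q) α
    (((q ∸ 1) div mp) + ((p ∸ 1) div mq) + (((p ∸ 1) * (q ∸ 1)) div (lcm mp mq)))
theorem1 p q p-prime q-prime p≢q α α-coprime mp mq p-card q-card =
  TwoPrimes.numComponents p q p-prime q-prime p≢q α α-coprime p-card q-card
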